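{- Let $\mathcal{M}$ be the set of Motzkin meanders that contain neither $UU$ nor $UD$ as a contiguous subword, and let $S(u)=\sum_{w\in\mathcal{M}} z^{|w|}u^{\mathrm{level}(w)}$. Put $$W=\sqrt{1-2z+z^2-4z^3},\qquad r_1=\frac{1-z-W}{2z^2}.$$ Then $$S(u)=\frac{(1+zu)r_1}{z(1-uzr_1)}.$$
   Context: A Motzkin meander is a finite word $w$ over $\{U,H,D\}$ (heights $+1,0,-1$) all of whose prefixes have nonnegative height sum; $|w|$ is its length and $\mathrm{level}(w)$ its total height sum; the empty word is included; excursions are meanders of level $0$. "Contains $XY$ as a contiguous subword" means two consecutive letters are $X$ then $Y$. Generating functions are formal power series in $z$; $W$ is the formal power series square root with constant term $1$. -}

module Defs where

open import Data.Nat using (ℕ; zero; suc; _∸_)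
open import Data.Bool using (Bool; true; false; _∧_; not)
open import Data.List using (List; []; _∷_; map; concatMap)
open import Data.Integer using (ℤ; +_; -[1+_]) renaming (_+_ to _+ℤ_; _*_ to _*ℤ_; _-_ to _-ℤ_; _≟_ to _≟ℤ_)
open import Relation.Nullary.Decidable using (⌊_⌋)

data Step : Set where
  U H D : Step

height : Step → ℤ
height U = + 1
height H = + 0
height D = -[1+ 0 ]

level : List Step → ℤ
level [] = + 0
level (s ∷ w) = height s +ℤ level w

meanderFrom : ℕ → List Step → Bool
meanderFrom h [] = true
meanderFrom h (U ∷ w) = meanderFrom (suc h) w
meanderFrom h (H ∷ w) = meanderFrom h w
meanderFrom zero (D ∷ w) = false
meanderFrom (suc h) (D ∷ w) = meanderFrom h w

isMeander : List Step → Bool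
isMeander = meanderFrom 0

isStep : Step → Step → Bool
isStep U U = true
isStep H H = true
isStep D D = true
isStep _ _ = false

containsPair : Step → Step → List Step → Bool
containsPair X Y [] = false
containsPair X Y (a ∷ []) = false
containsPair X Y (a ∷ b ∷ w) = (isStep a X ∧ isStep b Y) Data.Bool.∨ containsPair X Y (b ∷ w)

inM : List Step → Bool
inM w = isMeander w ∧ not (containsPair U U w) ∧ not (containsPair U D w)

words : ℕ → List (List Step)
words zero = [] ∷ []
words (suc n) = concatMap (λ w → map (λ s → s ∷ w) (U ∷ H ∷ D ∷ [])) (words n)

count : {A : Set} → (A → Bool) → List A → ℕ
count p [] = 0
count p (x ∷ xs) with p x
... | true = suc (count p xs)
... | false = count p xs

-- univariate: coefficient of z^n
Series : Set
Series = ℕ → ℤ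

-- bivariate: coefficient of z^n u^k
BSeries : Set
BSeries = ℕ → ℕ → ℤ

sumTo : ℕ → (ℕ → ℤ) → ℤ
sumTo zero f = f 0
sumTo (suc n) f = sumTo n f +ℤ f (suc n)

_*ₛ_ : Series → Series → Series
(f *ₛ g) n = sumTo n (λ i → f i *ℤ g (n ∸ i))

_+ₛ_ : Series → Series → Series
(f +ₛ g) n = f n +ℤ g n

_-ₛ_ : Series → Series → Series
(f -ₛ g) n = f n -ℤ g n

-- polynomial from its coefficient list (constant term first)
poly : List ℤ → Series
poly [] n = + 0
poly (c ∷ cs) zero = c
poly (c ∷ cs) (suc n) = poly cs n

_*ᵇ_ : BSeries → BSeries → BSeries
(f *ᵇ g) n k = sumTo n (λ i → sumTo k (λ j → f i j *ℤ g (n ∸ i) (k ∸ j)))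

_+ᵇ_ : BSeries → BSeries → BSeries
(f +ᵇ g) n k = f n k +ℤ g n k

_-ᵇ_ : BSeries → BSeries → BSeries
(f -ᵇ g) n k = f n k -ℤ g n k

lift : Series → BSeries
lift f n zero = f n
lift f n (suc k) = + 0

oneB zB uB : BSeries
oneB = lift (poly (+ 1 ∷ []))
zB = lift (poly (+ 0 ∷ + 1 ∷ []))
uB zero (suc zero) = + 1
uB _ _ = + 0

-- S(u) = Σ_{w ∈ 𝓜} z^|w| u^level(w): coefficient of z^n u^k is the
-- number of words of length n and level k in 𝓜

S : BSeries
S n k = + count (λ w → inM w ∧ ⌊ level w ≟ℤ + k ⌋) (words n)

-- Classify a word of 𝓜 by its height and by whether its last letter is U; appending a letter is
-- then a step of a small automaton. For the numbers f_k(n), t_k(n) of words of length n and level k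
-- not ending, resp. ending, in U this gives
--   f_k(n+1) = f_k(n) + t_k(n) + f_{k+1}(n),   t_{k+1}(n+1) = f_k(n),   t_0(n+1) = 0.
-- Squaring W = 1 - z - 2z²r₁ shows r₁ = z + z r₁ + z² r₁², so ρ_k = (z r₁)^k r₁ obeys the same
-- recurrence and z F_k = ρ_k, T_{k+1} = ρ_k for the generating functions F_k, T_k of f_k, t_k.
-- Comparing coefficients of u^k, the claimed identity then reduces to ρ_{k+1} = z r₁ ρ_k.

module Submission where

open import Defs
open import Data.List using (List; []; _∷_)
open import Data.Integer using (ℤ; +_; -[1+_])
open import Relation.Binary.PropositionalEquality using (_≡_; trans; sym)

module FormalPowerSeries where
  open import Data.Nat using (ℕ; zero; suc; _∸_; _≤_; _<_; z≤n; s≤s)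
  open import Data.Nat.Properties using (m≤n⇒m≤1+n; ≤-refl; m∸[m∸n]≡n)
  open import Data.Integer using (_+_; _*_; -_; _-_; NonZero)
  import Data.Integer.Properties as ℤ
  open import Data.Integer.Solver using (module +-*-Solver)
  open import Algebra.Properties.CommutativeSemigroup ℤ.+-commutativeSemigroup using (interchange)
  open import Algebra.Bundles using (CommutativeRing)
  open import Algebra.Solver.Ring.AlmostCommutativeRing
    using (fromCommutativeRing; _-Raw-AlmostCommutative⟶_)
  import Data.Maybe as Maybe
  open import Relation.Nullary.Decidable using (dec⇒maybe)
  open import Data.Product using (_,_)
  open import Function using (_∘_)
  open import Relation.Binary.PropositionalEquality
  import Relation.Binary.Reasoning.Setoid

  sumTo-cong≤ : ∀ n {f g : ℕ → ℤ} → (∀ i → i ≤ n → f i ≡ g i) → sumTo n f ≡ sumTo n g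
  sumTo-cong≤ zero    f≗g = f≗g 0 z≤n
  sumTo-cong≤ (suc n) f≗g =
    cong₂ _+_ (sumTo-cong≤ n (λ i i≤n → f≗g i (m≤n⇒m≤1+n i≤n))) (f≗g (suc n) ≤-refl)

  sumTo-cong : ∀ n {f g : ℕ → ℤ} → (∀ i → f i ≡ g i) → sumTo n f ≡ sumTo n g
  sumTo-cong n f≗g = sumTo-cong≤ n (λ i _ → f≗g i)

  sumTo-+ : ∀ n (f g : ℕ → ℤ) → sumTo n (λ i → f i + g i) ≡ sumTo n f + sumTo n g
  sumTo-+ zero    f g = refl
  sumTo-+ (suc n) f g =
    trans (cong (_+ (f (suc n) + g (suc n))) (sumTo-+ n f g))
          (interchange (sumTo n f) (sumTo n g) (f (suc n)) (g (suc n)))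

  sumTo-*ˡ : ∀ n c (f : ℕ → ℤ) → sumTo n (λ i → c * f i) ≡ c * sumTo n f
  sumTo-*ˡ zero    c f = refl
  sumTo-*ˡ (suc n) c f =
    trans (cong (_+ c * f (suc n)) (sumTo-*ˡ n c f)) (sym (ℤ.*-distribˡ-+ c _ _))

  sumTo-suc : ∀ n (f : ℕ → ℤ) → sumTo (suc n) f ≡ f 0 + sumTo n (f ∘ suc)
  sumTo-suc zero    f = refl
  sumTo-suc (suc n) f =
    trans (cong (_+ f (suc (suc n))) (sumTo-suc n f)) (ℤ.+-assoc (f 0) _ _)

  sumTo-zero : ∀ n (f : ℕ → ℤ) → (∀ i → f i ≡ + 0) → sumTo n f ≡ + 0
  sumTo-zero zero    f f≗0 = f≗0 0
  sumTo-zero (suc n) f f≗0 = cong₂ _+_ (sumTo-zero n f f≗0) (f≗0 (suc n))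

  sumTo-head : ∀ n (f : ℕ → ℤ) → (∀ i → f (suc i) ≡ + 0) → sumTo n f ≡ f 0
  sumTo-head zero    f f≗0 = refl
  sumTo-head (suc n) f f≗0 = trans (cong₂ _+_ (sumTo-head n f f≗0) (f≗0 n)) (ℤ.+-identityʳ (f 0))

  sumTo-last : ∀ n (f : ℕ → ℤ) → (∀ i → i < n → f i ≡ + 0) → sumTo n f ≡ f n
  sumTo-last zero    f f≗0 = refl
  sumTo-last (suc n) f f≗0 = trans (cong (_+ f (suc n)) init≡0) (ℤ.+-identityˡ (f (suc n)))
    where
    init≡0 : sumTo n f ≡ + 0
    init≡0 = trans (sumTo-cong≤ n (λ i i≤n → f≗0 i (s≤s i≤n))) (sumTo-zero n _ (λ _ → refl))

  sumTo-reverse : ∀ n (f : ℕ → ℤ) → sumTo n f ≡ sumTo n (λ i → f (n ∸ i))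
  sumTo-reverse zero    f = refl
  sumTo-reverse (suc n) f = begin
    sumTo n f + f (suc n)                  ≡⟨ cong (_+ f (suc n)) (sumTo-reverse n f) ⟩
    sumTo n (λ i → f (n ∸ i)) + f (suc n)  ≡⟨ ℤ.+-comm _ (f (suc n)) ⟩
    f (suc n) + sumTo n (λ i → f (n ∸ i))  ≡⟨ sym (sumTo-suc n (λ i → f (suc n ∸ i))) ⟩
    sumTo (suc n) (λ i → f (suc n ∸ i))    ∎
    where open ≡-Reasoning

  infix 4 _≈_
  _≈_ : Series → Series → Set
  f ≈ g = ∀ n → f n ≡ g n

  constₛ : ℤ → Series
  constₛ c = poly (c ∷ [])

  -- Zero is the solver's constant 0, so 0ₛ n only reduces once n is known (see 0ₛ-coeff).
  0ₛ 1ₛ zₛ : Series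
  0ₛ = constₛ (+ 0)
  1ₛ = constₛ (+ 1)
  zₛ = poly (+ 0 ∷ + 1 ∷ [])

  negₛ : Series → Series
  negₛ f n = - f n

  0ₛ-coeff : ∀ n → 0ₛ n ≡ + 0
  0ₛ-coeff zero    = refl
  0ₛ-coeff (suc n) = refl

  *ₛ-cong : ∀ {f f′ g g′} → f ≈ f′ → g ≈ g′ → f *ₛ g ≈ f′ *ₛ g′
  *ₛ-cong f≈f′ g≈g′ n = sumTo-cong n (λ i → cong₂ _*_ (f≈f′ i) (g≈g′ (n ∸ i)))

  *ₛ-suc : ∀ f g n → (f *ₛ g) (suc n) ≡ f 0 * g (suc n) + ((f ∘ suc) *ₛ g) n
  *ₛ-suc f g n = sumTo-suc n (λ i → f i * g (suc n ∸ i))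

  *ₛ-distribʳ : ∀ f g h → (f +ₛ g) *ₛ h ≈ (f *ₛ h) +ₛ (g *ₛ h)
  *ₛ-distribʳ f g h n =
    trans (sumTo-cong n (λ i → ℤ.*-distribʳ-+ (h (n ∸ i)) (f i) (g i))) (sumTo-+ n _ _)

  *ₛ-scaleˡ : ∀ c f h → (λ i → c * f i) *ₛ h ≈ (λ n → c * (f *ₛ h) n)
  *ₛ-scaleˡ c f h n =
    trans (sumTo-cong n (λ i → ℤ.*-assoc c (f i) (h (n ∸ i)))) (sumTo-*ˡ n c _)

  *ₛ-comm : ∀ f g → f *ₛ g ≈ g *ₛ f
  *ₛ-comm f g n = trans (sumTo-reverse n _) (sumTo-cong≤ n λ i i≤n →
    trans (cong (λ j → f (n ∸ i) * g j) (m∸[m∸n]≡n i≤n)) (ℤ.*-comm (f (n ∸ i)) (g i)))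

  *ₛ-identityˡ : ∀ f → 1ₛ *ₛ f ≈ f
  *ₛ-identityˡ f zero    = ℤ.*-identityˡ (f 0)
  *ₛ-identityˡ f (suc n) = begin
    (1ₛ *ₛ f) (suc n)                      ≡⟨ *ₛ-suc 1ₛ f n ⟩
    + 1 * f (suc n) + ((1ₛ ∘ suc) *ₛ f) n  ≡⟨ cong₂ _+_ (ℤ.*-identityˡ (f (suc n))) tail≡0 ⟩
    f (suc n) + + 0                        ≡⟨ ℤ.+-identityʳ (f (suc n)) ⟩
    f (suc n)                              ∎
    where
    open ≡-Reasoning
    tail≡0 : ((1ₛ ∘ suc) *ₛ f) n ≡ + 0
    tail≡0 = sumTo-zero n _ (λ i → ℤ.*-zeroˡ (f (n ∸ i)))

  *ₛ-assoc : ∀ f g h → (f *ₛ g) *ₛ h ≈ f *ₛ (g *ₛ h)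
  *ₛ-assoc f g h zero    = ℤ.*-assoc (f 0) (g 0) (h 0)
  *ₛ-assoc f g h (suc n) = begin
    ((f *ₛ g) *ₛ h) (suc n)
      ≡⟨ *ₛ-suc (f *ₛ g) h n ⟩
    (f 0 * g 0) * h (suc n) + (((f *ₛ g) ∘ suc) *ₛ h) n
      ≡⟨ cong (λ x → lead + x) (*ₛ-cong {g = h} (*ₛ-suc f g) (λ _ → refl) n) ⟩
    (f 0 * g 0) * h (suc n) + ((f₀g′ +ₛ ((f ∘ suc) *ₛ g)) *ₛ h) n
      ≡⟨ cong (λ x → lead + x) (*ₛ-distribʳ f₀g′ ((f ∘ suc) *ₛ g) h n) ⟩
    (f 0 * g 0) * h (suc n) + ((f₀g′ *ₛ h) n + (((f ∘ suc) *ₛ g) *ₛ h) n)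
      ≡⟨ cong₂ (λ a b → lead + (a + b)) (*ₛ-scaleˡ (f 0) (g ∘ suc) h n) (*ₛ-assoc (f ∘ suc) g h n) ⟩
    (f 0 * g 0) * h (suc n) + (f 0 * ((g ∘ suc) *ₛ h) n + ((f ∘ suc) *ₛ (g *ₛ h)) n)
      ≡⟨ regroup (f 0) (g 0) (h (suc n)) _ _ ⟩
    f 0 * (g 0 * h (suc n) + ((g ∘ suc) *ₛ h) n) + ((f ∘ suc) *ₛ (g *ₛ h)) n
      ≡⟨ cong (λ x → f 0 * x + rest) (sym (*ₛ-suc g h n)) ⟩
    f 0 * (g *ₛ h) (suc n) + ((f ∘ suc) *ₛ (g *ₛ h)) n
      ≡⟨ sym (*ₛ-suc f (g *ₛ h) n) ⟩
    (f *ₛ (g *ₛ h)) (suc n) ∎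
    where
    open ≡-Reasoning
    open +-*-Solver
    lead rest : ℤ
    lead = (f 0 * g 0) * h (suc n)
    rest = ((f ∘ suc) *ₛ (g *ₛ h)) n
    f₀g′ : Series
    f₀g′ m = f 0 * g (suc m)
    regroup : ∀ a b c d e → (a * b) * c + (a * d + e) ≡ a * (b * c + d) + e
    regroup = solve 5 (λ a b c d e → (a :* b) :* c :+ (a :* d :+ e) := a :* (b :* c :+ d) :+ e) refl

  seriesRing : CommutativeRing _ _
  seriesRing = record
    { Carrier = Series ; _≈_ = _≈_ ; _+_ = _+ₛ_ ; _*_ = _*ₛ_ ; -_ = negₛ ; 0# = 0ₛ ; 1# = 1ₛ
    ; isCommutativeRing = record
      { isRing = record
        { +-isAbelianGroup = record
          { isGroup = record
            { isMonoid = record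
              { isSemigroup = record
                { isMagma = record
                  { isEquivalence = record
                    { refl  = λ _ → refl
                    ; sym   = λ e n → sym (e n)
                    ; trans = λ e e′ n → trans (e n) (e′ n) }
                  ; ∙-cong = λ e e′ n → cong₂ _+_ (e n) (e′ n) }
                ; assoc = λ f g h n → ℤ.+-assoc (f n) (g n) (h n) }
              ; identity = (λ f n → trans (cong (_+ f n) (0ₛ-coeff n)) (ℤ.+-identityˡ (f n)))
                         , (λ f n → trans (cong (λ x → f n + x) (0ₛ-coeff n)) (ℤ.+-identityʳ (f n))) }
            ; inverse = (λ f n → trans (ℤ.+-inverseˡ (f n)) (sym (0ₛ-coeff n)))
                      , (λ f n → trans (ℤ.+-inverseʳ (f n)) (sym (0ₛ-coeff n)))
            ; ⁻¹-cong = λ e n → cong -_ (e n) }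
          ; comm = λ f g n → ℤ.+-comm (f n) (g n) }
        ; *-cong = *ₛ-cong
        ; *-assoc = *ₛ-assoc
        ; *-identity = *ₛ-identityˡ , (λ f n → trans (*ₛ-comm f 1ₛ n) (*ₛ-identityˡ f n))
        ; distrib = (λ h f g n → trans (*ₛ-comm h (f +ₛ g) n)
                                   (trans (*ₛ-distribʳ f g h n) (cong₂ _+_ (*ₛ-comm f h n) (*ₛ-comm g h n))))
                  , (λ h f g → *ₛ-distribʳ f g h) }
      ; *-comm = *ₛ-comm } }

  constₛ-*ₛ : ∀ c f → constₛ c *ₛ f ≈ (λ n → c * f n)
  constₛ-*ₛ c f n = sumTo-head n _ (λ i → ℤ.*-zeroˡ (f (n ∸ suc i)))

  constₛ-homomorphism : CommutativeRing.rawRing ℤ.+-*-commutativeRing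
                          -Raw-AlmostCommutative⟶ fromCommutativeRing seriesRing
  constₛ-homomorphism = record
    { ⟦_⟧    = constₛ
    ; +-homo = λ a b → λ { zero → refl ; (suc n) → refl }
    ; *-homo = λ a b n → sym (trans (constₛ-*ₛ a (constₛ b) n) (homo {a} {b} n))
    ; -‿homo = λ a → λ { zero → refl ; (suc n) → refl }
    ; 0-homo = λ _ → refl
    ; 1-homo = λ _ → refl }
    where
    homo : ∀ {a b} n → a * constₛ b n ≡ constₛ (a * b) n
    homo zero = refl
    homo {a} (suc n) = ℤ.*-zeroʳ a

  +ₛ-cong : ∀ {f f′ g g′} → f ≈ f′ → g ≈ g′ → f +ₛ g ≈ f′ +ₛ g′
  +ₛ-cong f≈f′ g≈g′ n = cong₂ _+_ (f≈f′ n) (g≈g′ n)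

  negₛ-cong : ∀ {f f′} → f ≈ f′ → negₛ f ≈ negₛ f′
  negₛ-cong f≈f′ n = cong -_ (f≈f′ n)

  -ₛ-cong : ∀ {f f′ g g′} → f ≈ f′ → g ≈ g′ → f -ₛ g ≈ f′ -ₛ g′
  -ₛ-cong f≈f′ g≈g′ n = cong₂ _-_ (f≈f′ n) (g≈g′ n)

  open CommutativeRing seriesRing public
    using () renaming (setoid to ≈-setoid; refl to ≈-refl; sym to ≈-sym; trans to ≈-trans)

  module ≈-Reasoning = Relation.Binary.Reasoning.Setoid ≈-setoid

  zₛ-*ₛ-suc : ∀ f n → (zₛ *ₛ f) (suc n) ≡ f n
  zₛ-*ₛ-suc f n = trans (*ₛ-suc zₛ f n) (trans (ℤ.+-identityˡ _) (*ₛ-identityˡ f n))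

  zₛ-cancel : ∀ f → zₛ *ₛ f ≈ 0ₛ → f ≈ 0ₛ
  zₛ-cancel f zf≈0 n = trans (sym (zₛ-*ₛ-suc f n)) (trans (zf≈0 (suc n)) (sym (0ₛ-coeff n)))

  constₛ-cancel : ∀ c .{{_ : NonZero c}} f → constₛ c *ₛ f ≈ 0ₛ → f ≈ 0ₛ
  constₛ-cancel c f cf≈0 n = trans fn≡0 (sym (0ₛ-coeff n))
    where
    fn≡0 : f n ≡ + 0
    fn≡0 = ℤ.*-cancelˡ-≡ c (f n) (+ 0)
      (trans (sym (constₛ-*ₛ c f n)) (trans (cf≈0 n) (trans (0ₛ-coeff n) (sym (ℤ.*-zeroʳ c)))))

  -- poly cs rewritten in terms of constₛ, zₛ, _+ₛ_ and _*ₛ_, the only shape the ring solver reads.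
  horner : List ℤ → Series
  horner []       = 0ₛ
  horner (c ∷ cs) = constₛ c +ₛ (zₛ *ₛ horner cs)

  poly≈horner : ∀ cs → poly cs ≈ horner cs
  poly≈horner []       n       = sym (0ₛ-coeff n)
  poly≈horner (c ∷ cs) zero    = sym (ℤ.+-identityʳ c)
  poly≈horner (c ∷ cs) (suc n) =
    sym (trans (ℤ.+-identityˡ _) (trans (zₛ-*ₛ-suc (horner cs) n) (sym (poly≈horner cs n))))

  open import Algebra.Solver.Ring (CommutativeRing.rawRing ℤ.+-*-commutativeRing)
    (fromCommutativeRing seriesRing) constₛ-homomorphism
    (λ a b → Maybe.map (λ a≡b n → cong (λ c → constₛ c n) a≡b) (dec⇒maybe (a ℤ.≟ b)))
    public using (solve; _:=_; con; _:+_; _:*_; _:-_; :-_)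

module Bivariate where
  open import Data.Nat using (ℕ; zero; suc; _∸_; _<_; s≤s)
  open import Data.Nat.Properties using (n∸n≡0; m+n∸n≡m)
  open import Data.Integer using (_+_; _*_)
  import Data.Integer.Properties as ℤ
  open import Relation.Binary.PropositionalEquality
  open FormalPowerSeries

  col : BSeries → ℕ → Series
  col F k n = F n k

  col-lift-suc : ∀ p k → col (lift p) (suc k) ≈ 0ₛ
  col-lift-suc p k n = sym (0ₛ-coeff n)

  col-*ᵇ-lift : ∀ F p k → col (F *ᵇ lift p) k ≈ col F k *ₛ p
  col-*ᵇ-lift F p k n = sumTo-cong n (λ i →
    trans (sumTo-last k _ (λ j j<k → trans (cong (F i j *_) (lift-above (n ∸ i) j<k)) (ℤ.*-zeroʳ (F i j))))
          (cong (λ l → F i k * lift p (n ∸ i) l) (n∸n≡0 k)))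
    where
    lift-above : ∀ m {j k} → j < k → lift p m (k ∸ j) ≡ + 0
    lift-above m {zero}  {suc k} _         = refl
    lift-above m {suc j} {suc k} (s≤s j<k) = lift-above m j<k

  col-lift-*ᵇ : ∀ p F k → col (lift p *ᵇ F) k ≈ p *ₛ col F k
  col-lift-*ᵇ p F k n = sumTo-cong n (λ i → sumTo-head k _ (λ j → refl))

  col-uB-*ᵇ-zero : ∀ F → col (uB *ᵇ F) 0 ≈ 0ₛ
  col-uB-*ᵇ-zero F n = trans (sumTo-head n _ (λ i → refl)) (sym (0ₛ-coeff n))

  col-uB-*ᵇ-suc : ∀ F k → col (uB *ᵇ F) (suc k) ≈ col F k
  col-uB-*ᵇ-suc F k n = begin
    (uB *ᵇ F) n (suc k)
      ≡⟨ sumTo-head n _ (λ i → sumTo-zero (suc k) _ (λ j → refl)) ⟩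
    sumTo (suc k) (λ j → uB 0 j * F n (suc k ∸ j))
      ≡⟨ trans (sumTo-suc k _) (ℤ.+-identityˡ _) ⟩
    sumTo k (λ j → uB 0 (suc j) * F n (k ∸ j))
      ≡⟨ trans (sumTo-head k _ (λ j → refl)) (ℤ.*-identityˡ (F n k)) ⟩
    F n k ∎
    where open ≡-Reasoning

  col-*ᵇ-suc : ∀ F G → (∀ n j → G n (suc (suc j)) ≡ + 0) →
               ∀ k → col (F *ᵇ G) (suc k) ≈ (col F k *ₛ col G 1) +ₛ (col F (suc k) *ₛ col G 0)
  col-*ᵇ-suc F G G≡0 k n = trans (sumTo-cong n inner) (sumTo-+ n _ _)
    where
    G-above : ∀ m {j k} → j < k → G m (suc k ∸ j) ≡ + 0
    G-above m {zero}  {suc k} _         = G≡0 m k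
    G-above m {suc j} {suc k} (s≤s j<k) = G-above m j<k
    inner : ∀ i → sumTo (suc k) (λ j → F i j * G (n ∸ i) (suc k ∸ j))
                ≡ F i k * G (n ∸ i) 1 + F i (suc k) * G (n ∸ i) 0
    inner i = cong₂ _+_
      (trans (sumTo-last k _ (λ j j<k → trans (cong (F i j *_) (G-above (n ∸ i) j<k)) (ℤ.*-zeroʳ (F i j))))
             (cong (λ l → F i k * G (n ∸ i) l) (m+n∸n≡m 1 k)))
      (cong (λ l → F i (suc k) * G (n ∸ i) l) (n∸n≡0 k))

module Counting where
  open import Data.Nat using (ℕ; zero; suc; _+_; _≡ᵇ_)
  import Data.Nat.Properties as ℕ
  open import Algebra.Properties.CommutativeSemigroup ℕ.+-commutativeSemigroup using (interchange)
  open import Data.Bool using (Bool; true; false; _∧_; _∨_; not)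
  import Data.Bool.Properties as Bool
  open import Data.List using (List; []; _∷_; [_]; _++_; foldl; map; concatMap)
  open import Data.List.Properties using (foldl-∷ʳ)
  open import Data.Maybe using (Maybe; just; nothing; _>>=_)
  open import Data.Product using (_×_; _,_)
  open import Data.Integer using () renaming (_+_ to _+ℤ_; _≟_ to _≟ℤ_)
  import Data.Integer.Properties as ℤ
  open import Relation.Nullary.Decidable using (⌊_⌋; isYes≗does)
  open import Relation.Binary.PropositionalEquality hiding ([_])

  indicator : Bool → ℕ
  indicator true  = 1
  indicator false = 0

  count-∷ : ∀ {A : Set} (p : A → Bool) x xs → count p (x ∷ xs) ≡ indicator (p x) + count p xs
  count-∷ p x xs with p x
  ... | true  = refl
  ... | false = refl

  count-cong : ∀ {A : Set} {p q : A → Bool} xs → (∀ x → p x ≡ q x) → count p xs ≡ count q xs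
  count-cong         []       p≗q = refl
  count-cong {p = p} {q} (x ∷ xs) p≗q = begin
    count p (x ∷ xs)                    ≡⟨ count-∷ p x xs ⟩
    indicator (p x) + count p xs        ≡⟨ cong₂ _+_ (cong indicator (p≗q x)) (count-cong xs p≗q) ⟩
    indicator (q x) + count q xs        ≡⟨ count-∷ q x xs ⟨
    count q (x ∷ xs)                    ∎
    where open ≡-Reasoning

  count-false : ∀ {A : Set} (xs : List A) → count (λ _ → false) xs ≡ 0
  count-false []       = refl
  count-false (x ∷ xs) = count-false xs

  count-∨ : ∀ {A : Set} (p q : A → Bool) xs → (∀ x → p x ∧ q x ≡ false) →
            count (λ x → p x ∨ q x) xs ≡ count p xs + count q xs
  count-∨ p q []       disjoint = refl
  count-∨ p q (x ∷ xs) disjoint with p x | q x | disjoint x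
  ... | true  | false | _ = cong suc (count-∨ p q xs disjoint)
  ... | false | true  | _ = trans (cong suc (count-∨ p q xs disjoint)) (sym (ℕ.+-suc _ _))
  ... | false | false | _ = count-∨ p q xs disjoint

  Σ-steps : (Step → ℕ) → ℕ
  Σ-steps f = (f U + f H) + f D

  Σ-steps-cong : ∀ {f g : Step → ℕ} → (∀ s → f s ≡ g s) → Σ-steps f ≡ Σ-steps g
  Σ-steps-cong f≗g = cong₂ _+_ (cong₂ _+_ (f≗g U) (f≗g H)) (f≗g D)

  Σ-steps-+ : ∀ f g → Σ-steps f + Σ-steps g ≡ Σ-steps (λ s → f s + g s)
  Σ-steps-+ f g = trans (interchange (f U + f H) (f D) (g U + g H) (g D))
                        (cong (_+ (f D + g D)) (interchange (f U) (f H) (g U) (g H)))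

  Σ-steps-swap : ∀ (f : Step → Step → ℕ) →
                 Σ-steps (λ s → Σ-steps (f s)) ≡ Σ-steps (λ t → Σ-steps (λ s → f s t))
  Σ-steps-swap f = sym (trans (cong (_+ Σ-steps (λ s → f s D)) (Σ-steps-+ (λ s → f s U) (λ s → f s H)))
                              (Σ-steps-+ (λ s → f s U + f s H) (λ s → f s D)))

  count-prepend : ∀ (p : List Step → Bool) ws →
    count p (concatMap (λ w → map (λ s → s ∷ w) (U ∷ H ∷ D ∷ [])) ws)
    ≡ Σ-steps (λ s → count (λ w → p (s ∷ w)) ws)
  count-prepend p []       = refl
  count-prepend p (w ∷ ws) = begin
    count p ((U ∷ w) ∷ (H ∷ w) ∷ (D ∷ w) ∷ rest)
      ≡⟨ trans (count-∷ p _ _) (cong (λ n → a U + n)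
           (trans (count-∷ p _ _) (cong (λ n → a H + n) (count-∷ p _ _)))) ⟩
    a U + (a H + (a D + count p rest))
      ≡⟨ sym (trans (ℕ.+-assoc (a U + a H) (a D) _) (ℕ.+-assoc (a U) (a H) _)) ⟩
    Σ-steps a + count p rest
      ≡⟨ cong (λ n → Σ-steps a + n) (count-prepend p ws) ⟩
    Σ-steps a + Σ-steps (λ s → count (λ v → p (s ∷ v)) ws)
      ≡⟨ Σ-steps-+ a (λ s → count (λ v → p (s ∷ v)) ws) ⟩
    Σ-steps (λ s → a s + count (λ v → p (s ∷ v)) ws)
      ≡⟨ Σ-steps-cong (λ s → count-∷ (λ v → p (s ∷ v)) w ws) ⟨
    Σ-steps (λ s → count (λ v → p (s ∷ v)) (w ∷ ws)) ∎
    where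
    open ≡-Reasoning
    rest : List (List Step)
    rest = concatMap (λ v → map (λ s → s ∷ v) (U ∷ H ∷ D ∷ [])) ws
    a : Step → ℕ
    a s = indicator (p (s ∷ w))

  -- words adds letters at the front, but the automaton reads from the left.
  count-words-append : ∀ n (p : List Step → Bool) →
    count p (words (suc n)) ≡ Σ-steps (λ s → count (λ w → p (w ++ [ s ])) (words n))
  count-words-append zero    p = trans (count-prepend p (words 0))
    (Σ-steps-cong (λ s → trans (count-∷ (λ w → p (s ∷ w)) [] [])
                               (sym (count-∷ (λ w → p (w ++ [ s ])) [] []))))
  count-words-append (suc n) p = begin
    count p (words (suc (suc n)))
      ≡⟨ count-prepend p (words (suc n)) ⟩
    Σ-steps (λ s → count (λ w → p (s ∷ w)) (words (suc n)))
      ≡⟨ Σ-steps-cong (λ s → count-words-append n (λ w → p (s ∷ w))) ⟩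
    Σ-steps (λ s → Σ-steps (λ t → count (λ w → p (s ∷ w ++ [ t ])) (words n)))
      ≡⟨ Σ-steps-swap (λ s t → count (λ w → p (s ∷ w ++ [ t ])) (words n)) ⟩
    Σ-steps (λ t → Σ-steps (λ s → count (λ w → p (s ∷ w ++ [ t ])) (words n)))
      ≡⟨ Σ-steps-cong (λ t → count-prepend (λ w → p (w ++ [ t ])) (words n)) ⟨
    Σ-steps (λ t → count (λ w → p (w ++ [ t ])) (words (suc n))) ∎
    where open ≡-Reasoning

  -- The current height, and whether the last letter read was U.
  Config : Set
  Config = ℕ × Bool

  step : Config → Step → Maybe Config
  step (h     , false) U = just (suc h , true)
  step (h     , true)  U = nothing
  step (h     , _)     H = just (h , false)
  step (zero  , false) D = nothing
  step (suc h , false) D = just (h , false)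
  step (h     , true)  D = nothing

  _⊳_ : Maybe Config → Step → Maybe Config
  c ⊳ s = c >>= λ c′ → step c′ s

  run : Maybe Config → List Step → Maybe Config
  run = foldl _⊳_

  run-nothing : ∀ w → run nothing w ≡ nothing
  run-nothing []      = refl
  run-nothing (_ ∷ w) = run-nothing w

  endsAt : ℕ → Bool → Maybe Config → Bool
  endsAt k b     nothing              = false
  endsAt k false (just (h , false))   = h ≡ᵇ k
  endsAt k false (just (h , true))    = false
  endsAt k true  (just (h , true))    = h ≡ᵇ k
  endsAt k true  (just (h , false))   = false

  accepts : ℕ → Maybe Config → Bool
  accepts k c = endsAt k false c ∨ endsAt k true c

  leadingU : Bool → List Step → List Step
  leadingU false w = w
  leadingU true  w = U ∷ w

  containsPair-H : ∀ Y w → containsPair U Y (H ∷ w) ≡ containsPair U Y w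
  containsPair-H Y []      = refl
  containsPair-H Y (_ ∷ w) = refl

  containsPair-D : ∀ Y w → containsPair U Y (D ∷ w) ≡ containsPair U Y w
  containsPair-D Y []      = refl
  containsPair-D Y (_ ∷ w) = refl

  level-U : ∀ h l → + h +ℤ (+ 1 +ℤ l) ≡ + suc h +ℤ l
  level-U h l = trans (sym (ℤ.+-assoc (+ h) (+ 1) l)) (cong (_+ℤ l) (ℤ.+-comm (+ h) (+ 1)))

  level-H : ∀ h l → + h +ℤ (+ 0 +ℤ l) ≡ + h +ℤ l
  level-H h l = cong (+ h +ℤ_) (ℤ.+-identityˡ l)

  level-D : ∀ h l → + suc h +ℤ (-[1+ 0 ] +ℤ l) ≡ + h +ℤ l
  level-D h l = trans (sym (ℤ.+-assoc (+ suc h) -[1+ 0 ] l)) (cong (_+ℤ l) (ℤ.+-comm (+ suc h) -[1+ 0 ]))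

  -- leadingU b w puts back the U remembered by the flag, so that a forbidden pair UU or UD
  -- straddling the current position is still seen.
  accepts-run : ∀ h b k w →
    meanderFrom h w ∧ (not (containsPair U U (leadingU b w)) ∧
      (not (containsPair U D (leadingU b w)) ∧ ⌊ + h +ℤ level w ≟ℤ + k ⌋))
    ≡ accepts k (run (just (h , b)) w)
  accepts-run h false k [] =
    trans (cong (λ l → ⌊ l ≟ℤ + k ⌋) (ℤ.+-identityʳ (+ h)))
          (trans (isYes≗does (+ h ≟ℤ + k)) (sym (Bool.∨-identityʳ (h ≡ᵇ k))))
  accepts-run h true k [] =
    trans (cong (λ l → ⌊ l ≟ℤ + k ⌋) (ℤ.+-identityʳ (+ h))) (isYes≗does (+ h ≟ℤ + k))
  accepts-run h false k (U ∷ w) rewrite level-U h (level w) = accepts-run (suc h) true k w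
  accepts-run h false k (H ∷ w)
    rewrite level-H h (level w) | containsPair-H U w | containsPair-H D w = accepts-run h false k w
  accepts-run zero false k (D ∷ w) = sym (cong (accepts k) (run-nothing w))
  accepts-run (suc h) false k (D ∷ w)
    rewrite level-D h (level w) | containsPair-D U w | containsPair-D D w = accepts-run h false k w
  accepts-run h true k (U ∷ w) =
    trans (Bool.∧-zeroʳ (meanderFrom (suc h) w)) (sym (cong (accepts k) (run-nothing w)))
  accepts-run h true k (H ∷ w)
    rewrite level-H h (level w) | containsPair-H U w | containsPair-H D w = accepts-run h false k w
  accepts-run h true k (D ∷ w) =
    trans (cong (meanderFrom h (D ∷ w) ∧_) (Bool.∧-zeroʳ (not (containsPair U U (D ∷ w)))))
          (trans (Bool.∧-zeroʳ (meanderFrom h (D ∷ w))) (sym (cong (accepts k) (run-nothing w))))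

  start : Maybe Config
  start = just (0 , false)

  inM-accepts : ∀ k w → (inM w ∧ ⌊ level w ≟ℤ + k ⌋) ≡ accepts k (run start w)
  inM-accepts k w = begin
    (isMeander w ∧ (noUU ∧ noUD)) ∧ ⌊ level w ≟ℤ + k ⌋
      ≡⟨ trans (Bool.∧-assoc (isMeander w) _ _) (cong (isMeander w ∧_) (Bool.∧-assoc noUU noUD _)) ⟩
    isMeander w ∧ (noUU ∧ (noUD ∧ ⌊ level w ≟ℤ + k ⌋))
      ≡⟨ cong (λ l → isMeander w ∧ (noUU ∧ (noUD ∧ ⌊ l ≟ℤ + k ⌋)))
              (ℤ.+-identityˡ (level w)) ⟨
    isMeander w ∧ (noUU ∧ (noUD ∧ ⌊ + 0 +ℤ level w ≟ℤ + k ⌋))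
      ≡⟨ accepts-run 0 false k w ⟩
    accepts k (run start w) ∎
    where
    open ≡-Reasoning
    noUU noUD : Bool
    noUU = not (containsPair U U w)
    noUD = not (containsPair U D w)

  endsAt-disjoint : ∀ k c → endsAt k false c ∧ endsAt k true c ≡ false
  endsAt-disjoint k nothing            = refl
  endsAt-disjoint k (just (h , false)) = Bool.∧-zeroʳ (h ≡ᵇ k)
  endsAt-disjoint k (just (h , true))  = refl

  endsAt-false-⊳U : ∀ k c → endsAt k false (c ⊳ U) ≡ false
  endsAt-false-⊳U k nothing            = refl
  endsAt-false-⊳U k (just (h , false)) = refl
  endsAt-false-⊳U k (just (h , true))  = refl

  endsAt-false-⊳H : ∀ k c → endsAt k false (c ⊳ H) ≡ accepts k c
  endsAt-false-⊳H k nothing            = refl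
  endsAt-false-⊳H k (just (h , false)) = sym (Bool.∨-identityʳ (h ≡ᵇ k))
  endsAt-false-⊳H k (just (h , true))  = refl

  endsAt-false-⊳D : ∀ k c → endsAt k false (c ⊳ D) ≡ endsAt (suc k) false c
  endsAt-false-⊳D k nothing                = refl
  endsAt-false-⊳D k (just (zero , false))  = refl
  endsAt-false-⊳D k (just (suc h , false)) = refl
  endsAt-false-⊳D k (just (h , true))      = refl

  endsAt-true-⊳U-zero : ∀ c → endsAt 0 true (c ⊳ U) ≡ false
  endsAt-true-⊳U-zero nothing            = refl
  endsAt-true-⊳U-zero (just (h , false)) = refl
  endsAt-true-⊳U-zero (just (h , true))  = refl

  endsAt-true-⊳U-suc : ∀ k c → endsAt (suc k) true (c ⊳ U) ≡ endsAt k false c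
  endsAt-true-⊳U-suc k nothing            = refl
  endsAt-true-⊳U-suc k (just (h , false)) = refl
  endsAt-true-⊳U-suc k (just (h , true))  = refl

  endsAt-true-⊳H : ∀ k c → endsAt k true (c ⊳ H) ≡ false
  endsAt-true-⊳H k nothing            = refl
  endsAt-true-⊳H k (just (h , false)) = refl
  endsAt-true-⊳H k (just (h , true))  = refl

  endsAt-true-⊳D : ∀ k c → endsAt k true (c ⊳ D) ≡ false
  endsAt-true-⊳D k nothing                = refl
  endsAt-true-⊳D k (just (zero , false))  = refl
  endsAt-true-⊳D k (just (suc h , false)) = refl
  endsAt-true-⊳D k (just (h , true))      = refl

  endCount : Bool → ℕ → ℕ → ℕ
  endCount b k n = count (λ w → endsAt k b (run start w)) (words n)

  S-endCount : ∀ n k → S n k ≡ + (endCount false k n + endCount true k n)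
  S-endCount n k = cong +_ (trans (count-cong (words n) (inM-accepts k))
    (count-∨ _ _ (words n) (λ w → endsAt-disjoint k (run start w))))

  count-append : ∀ n k b s (q : Maybe Config → Bool) → (∀ c → endsAt k b (c ⊳ s) ≡ q c) →
    count (λ w → endsAt k b (run start (w ++ [ s ]))) (words n) ≡ count (λ w → q (run start w)) (words n)
  count-append n k b s q table =
    count-cong (words n) (λ w → trans (cong (endsAt k b) (foldl-∷ʳ _⊳_ start s w)) (table (run start w)))

  endCount-false-suc : ∀ n k →
    endCount false k (suc n) ≡ (endCount false k n + endCount true k n) + endCount false (suc k) n
  endCount-false-suc n k = trans (count-words-append n _) (cong₂ _+_ (cong₂ _+_
    (trans (count-append n k false U _ (endsAt-false-⊳U k)) (count-false (words n)))
    (trans (count-append n k false H _ (endsAt-false-⊳H k))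
           (count-∨ _ _ (words n) (λ w → endsAt-disjoint k (run start w)))))
    (count-append n k false D _ (endsAt-false-⊳D k)))

  endCount-true-zero : ∀ n → endCount true 0 (suc n) ≡ 0
  endCount-true-zero n = trans (count-words-append n _) (cong₂ _+_ (cong₂ _+_
    (trans (count-append n 0 true U _ endsAt-true-⊳U-zero) (count-false (words n)))
    (trans (count-append n 0 true H _ (endsAt-true-⊳H 0)) (count-false (words n))))
    (trans (count-append n 0 true D _ (endsAt-true-⊳D 0)) (count-false (words n))))

  endCount-true-suc : ∀ n k → endCount true (suc k) (suc n) ≡ endCount false k n
  endCount-true-suc n k = trans (count-words-append n _) (trans (cong₂ _+_ (cong₂ _+_
    (count-append n (suc k) true U _ (endsAt-true-⊳U-suc k))
    (trans (count-append n (suc k) true H _ (endsAt-true-⊳H (suc k))) (count-false (words n))))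
    (trans (count-append n (suc k) true D _ (endsAt-true-⊳D (suc k))) (count-false (words n))))
    (trans (ℕ.+-identityʳ _) (ℕ.+-identityʳ _)))

module Solution
  (W r : Series)
  (W²≈P : ∀ n → (W *ₛ W) n ≡ poly (+ 1 ∷ -[1+ 1 ] ∷ + 1 ∷ -[1+ 3 ] ∷ []) n)
  (2z²r≈1-z-W : ∀ n → (poly (+ 0 ∷ + 0 ∷ + 2 ∷ []) *ₛ r) n
                      ≡ (poly (+ 1 ∷ -[1+ 0 ] ∷ []) -ₛ W) n)
  where

  open import Data.Nat using (ℕ; zero; suc)
  open import Data.Bool using (false; true)
  open import Data.Integer using (_+_; _-_)
  import Data.Integer.Properties as ℤ
  open import Data.Product using (_×_; _,_; proj₁; proj₂)
  open import Relation.Binary.PropositionalEquality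
  open FormalPowerSeries
  open Bivariate
  open Counting using (endCount; S-endCount; endCount-false-suc; endCount-true-zero; endCount-true-suc)

  1-zₕ 2z²ₕ Pₕ : Series
  1-zₕ = horner (+ 1 ∷ -[1+ 0 ] ∷ [])
  2z²ₕ = horner (+ 0 ∷ + 0 ∷ + 2 ∷ [])
  Pₕ   = horner (+ 1 ∷ -[1+ 1 ] ∷ + 1 ∷ -[1+ 3 ] ∷ [])

  W≈1-z-2z²r : W ≈ (1-zₕ -ₛ (2z²ₕ *ₛ r))
  W≈1-z-2z²r = begin
    W
      ≈⟨ solve 2 (λ z w → w := (con (+ 1) :+ z :* (con -[1+ 0 ] :+ z :* con (+ 0)))
                              :- ((con (+ 1) :+ z :* (con -[1+ 0 ] :+ z :* con (+ 0))) :- w))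
                 (λ _ → refl) zₛ W ⟩
    (1-zₕ -ₛ (1-zₕ -ₛ W))
      ≈⟨ -ₛ-cong (≈-refl {1-zₕ})
                 (-ₛ-cong (≈-sym (poly≈horner (+ 1 ∷ -[1+ 0 ] ∷ []))) (≈-refl {W})) ⟩
    (1-zₕ -ₛ (poly (+ 1 ∷ -[1+ 0 ] ∷ []) -ₛ W))
      ≈⟨ -ₛ-cong (≈-refl {1-zₕ}) (≈-sym 2z²r≈1-z-W) ⟩
    (1-zₕ -ₛ (poly (+ 0 ∷ + 0 ∷ + 2 ∷ []) *ₛ r))
      ≈⟨ -ₛ-cong (≈-refl {1-zₕ}) (*ₛ-cong (poly≈horner (+ 0 ∷ + 0 ∷ + 2 ∷ [])) (≈-refl {r})) ⟩
    (1-zₕ -ₛ (2z²ₕ *ₛ r))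
      ∎
    where open ≈-Reasoning

  kernel : Series
  kernel = (((zₛ *ₛ (zₛ *ₛ (r *ₛ r))) -ₛ r) +ₛ (zₛ *ₛ r)) +ₛ zₛ

  -- Squaring W = 1 - z - 2z²r and subtracting W² = P leaves exactly 4z² · kernel.
  4z²kernel≈W²-P : (constₛ (+ 4) *ₛ (zₛ *ₛ (zₛ *ₛ kernel))) ≈ ((W *ₛ W) -ₛ Pₕ)
  4z²kernel≈W²-P = begin
    (constₛ (+ 4) *ₛ (zₛ *ₛ (zₛ *ₛ kernel)))
      ≈⟨ solve 2 (λ z y →
           let 1-z = con (+ 1) :+ z :* (con -[1+ 0 ] :+ z :* con (+ 0))
               2z² = con (+ 0) :+ z :* (con (+ 0) :+ z :* (con (+ 2) :+ z :* con (+ 0)))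
               P   = con (+ 1) :+ z :* (con -[1+ 1 ] :+ z :* (con (+ 1) :+ z :* (con -[1+ 3 ] :+ z :* con (+ 0))))
           in con (+ 4) :* (z :* (z :* ((((z :* (z :* (y :* y))) :- y) :+ (z :* y)) :+ z)))
              := ((1-z :- 2z² :* y) :* (1-z :- 2z² :* y)) :- P)
           (λ _ → refl) zₛ r ⟩
    (((1-zₕ -ₛ (2z²ₕ *ₛ r)) *ₛ (1-zₕ -ₛ (2z²ₕ *ₛ r))) -ₛ Pₕ)
      ≈⟨ -ₛ-cong (*ₛ-cong (≈-sym W≈1-z-2z²r) (≈-sym W≈1-z-2z²r)) (≈-refl {Pₕ}) ⟩
    ((W *ₛ W) -ₛ Pₕ)
      ∎
    where open ≈-Reasoning

  kernel≈0 : kernel ≈ 0ₛ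
  kernel≈0 = zₛ-cancel kernel (zₛ-cancel (zₛ *ₛ kernel)
    (constₛ-cancel (+ 4) _ (≈-trans 4z²kernel≈W²-P W²-P≈0)))
    where
    P : Series
    P = poly (+ 1 ∷ -[1+ 1 ] ∷ + 1 ∷ -[1+ 3 ] ∷ [])
    W²-P≈0 : ((W *ₛ W) -ₛ Pₕ) ≈ 0ₛ
    W²-P≈0 n =
      trans (cong₂ _-_ (W²≈P n) (sym (poly≈horner (+ 1 ∷ -[1+ 1 ] ∷ + 1 ∷ -[1+ 3 ] ∷ []) n)))
            (trans (ℤ.+-inverseʳ (P n)) (sym (0ₛ-coeff n)))

  r-quadratic : r ≈ ((zₛ +ₛ (zₛ *ₛ r)) +ₛ (zₛ *ₛ (zₛ *ₛ (r *ₛ r))))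
  r-quadratic = begin
    r              ≈⟨ solve 2 (λ z y → y := ((z :+ z :* y) :+ z :* (z :* (y :* y)))
                                           :- (((z :* (z :* (y :* y)) :- y) :+ z :* y) :+ z))
                              (λ _ → refl) zₛ r ⟩
    (Q -ₛ kernel)  ≈⟨ -ₛ-cong (≈-refl {Q}) kernel≈0 ⟩
    (Q -ₛ 0ₛ)      ≈⟨ (λ n → trans (cong (Q n -_) (0ₛ-coeff n)) (ℤ.+-identityʳ (Q n))) ⟩
    Q              ∎
    where
    open ≈-Reasoning
    Q : Series
    Q = (zₛ +ₛ (zₛ *ₛ r)) +ₛ (zₛ *ₛ (zₛ *ₛ (r *ₛ r)))

  ρ : ℕ → Series
  ρ zero    = r
  ρ (suc k) = (zₛ *ₛ r) *ₛ ρ k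

  ρ⁻ : ℕ → Series
  ρ⁻ zero    = 0ₛ
  ρ⁻ (suc k) = ρ k

  δ₀ : ℕ → Series
  δ₀ zero    = zₛ
  δ₀ (suc k) = 0ₛ

  -- The recurrence endCount-false-suc multiplied by z; δ₀ accounts for the empty word.
  ρ-equation : ∀ k →
    ρ k ≈ (((δ₀ k +ₛ (zₛ *ₛ ρ k)) +ₛ (zₛ *ₛ (zₛ *ₛ ρ⁻ k))) +ₛ (zₛ *ₛ ρ (suc k)))
  ρ-equation zero = ≈-trans r-quadratic
    (solve 2 (λ z y → (z :+ z :* y) :+ z :* (z :* (y :* y))
                   := ((z :+ z :* y) :+ z :* (z :* con (+ 0))) :+ z :* ((z :* y) :* y))
             (λ _ → refl) zₛ r)
  ρ-equation (suc k) = ≈-trans (*ₛ-cong (*ₛ-cong (≈-refl {zₛ}) r-quadratic) (≈-refl {ρ k}))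
    (solve 3 (λ z y g → (z :* ((z :+ z :* y) :+ z :* (z :* (y :* y)))) :* g
                     := ((con (+ 0) :+ z :* ((z :* y) :* g)) :+ z :* (z :* g)) :+ z :* ((z :* y) :* ((z :* y) :* g)))
             (λ _ → refl) zₛ r (ρ k))

  ρ-coeff-zero : ∀ k → ρ k 0 ≡ + 0
  ρ-coeff-zero zero    = ρ-equation zero 0
  ρ-coeff-zero (suc k) = ρ-equation (suc k) 0

  ρ-coeff-suc : ∀ k n → ρ k (suc n) ≡ ((δ₀ k (suc n) + ρ k n) + (zₛ *ₛ ρ⁻ k) n) + ρ (suc k) n
  ρ-coeff-suc k n = trans (ρ-equation k (suc n)) (cong₂ _+_
    (cong₂ _+_ (cong (λ x → δ₀ k (suc n) + x) (zₛ-*ₛ-suc (ρ k) n)) (zₛ-*ₛ-suc (zₛ *ₛ ρ⁻ k) n))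
    (zₛ-*ₛ-suc (ρ (suc k)) n))

  ρ-coeff-one : ∀ k → ρ k 1 ≡ δ₀ k 1
  ρ-coeff-one k = begin
    ρ k 1
      ≡⟨ ρ-coeff-suc k 0 ⟩
    ((δ₀ k 1 + ρ k 0) + + 0) + ρ (suc k) 0
      ≡⟨ cong₂ (λ a b → ((δ₀ k 1 + a) + + 0) + b) (ρ-coeff-zero k) (ρ-coeff-zero (suc k)) ⟩
    ((δ₀ k 1 + + 0) + + 0) + + 0
      ≡⟨ trans (ℤ.+-identityʳ _) (trans (ℤ.+-identityʳ _) (ℤ.+-identityʳ _)) ⟩
    δ₀ k 1
      ∎
    where open ≡-Reasoning

  ρ-coeff-suc-suc : ∀ k m → ρ k (suc (suc m)) ≡ (ρ k (suc m) + ρ⁻ k m) + ρ (suc k) (suc m)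
  ρ-coeff-suc-suc k m = trans (ρ-coeff-suc k (suc m)) (cong₂ (λ a b → (a + b) + ρ (suc k) (suc m))
    (trans (cong (_+ ρ k (suc m)) (δ₀-high k)) (ℤ.+-identityˡ (ρ k (suc m)))) (zₛ-*ₛ-suc (ρ⁻ k) m))
    where
    δ₀-high : ∀ k → δ₀ k (suc (suc m)) ≡ + 0
    δ₀-high zero    = refl
    δ₀-high (suc k) = refl

  endCount-ρ : ∀ m → (∀ k → + endCount false k m ≡ ρ k (suc m))
                   × (∀ k → + endCount true k m ≡ ρ⁻ k m)
  endCount-ρ zero = (λ { zero → sym (ρ-coeff-one zero) ; (suc k) → sym (ρ-coeff-one (suc k)) })
                  , (λ { zero → refl ; (suc k) → sym (ρ-coeff-zero k) })
  endCount-ρ (suc m) = false-case , true-case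
    where
    false-case : ∀ k → + endCount false k (suc m) ≡ ρ k (suc (suc m))
    false-case k = begin
      + endCount false k (suc m)
        ≡⟨ cong +_ (endCount-false-suc m k) ⟩
      (+ endCount false k m + + endCount true k m) + + endCount false (suc k) m
        ≡⟨ cong₂ _+_ (cong₂ _+_ (proj₁ (endCount-ρ m) k) (proj₂ (endCount-ρ m) k))
                     (proj₁ (endCount-ρ m) (suc k)) ⟩
      (ρ k (suc m) + ρ⁻ k m) + ρ (suc k) (suc m)
        ≡⟨ ρ-coeff-suc-suc k m ⟨
      ρ k (suc (suc m)) ∎
      where open ≡-Reasoning
    true-case : ∀ k → + endCount true k (suc m) ≡ ρ⁻ k (suc m)
    true-case zero    = cong +_ (endCount-true-zero m)
    true-case (suc k) = trans (cong +_ (endCount-true-suc m k)) (proj₁ (endCount-ρ m) k)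

  z*col-S : ∀ k → (zₛ *ₛ col S k) ≈ (ρ k +ₛ (zₛ *ₛ ρ⁻ k))
  z*col-S k = begin
    (zₛ *ₛ col S k)
      ≈⟨ *ₛ-cong (≈-refl {zₛ}) (λ n → S-endCount n k) ⟩
    (zₛ *ₛ (F +ₛ T))
      ≈⟨ solve 3 (λ z f t → z :* (f :+ t) := z :* f :+ z :* t) (λ _ → refl) zₛ F T ⟩
    ((zₛ *ₛ F) +ₛ (zₛ *ₛ T))
      ≈⟨ +ₛ-cong zF≈ρ (*ₛ-cong (≈-refl {zₛ}) (λ n → proj₂ (endCount-ρ n) k)) ⟩
    (ρ k +ₛ (zₛ *ₛ ρ⁻ k))
      ∎
    where
    open ≈-Reasoning
    F T : Series
    F n = + endCount false k n
    T n = + endCount true k n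
    zF≈ρ : (zₛ *ₛ F) ≈ ρ k
    zF≈ρ zero    = sym (ρ-coeff-zero k)
    zF≈ρ (suc n) = trans (zₛ-*ₛ-suc F n) (proj₁ (endCount-ρ n) k)

  Z Rb : BSeries
  Z  = zB *ᵇ (oneB -ᵇ ((uB *ᵇ zB) *ᵇ lift r))
  Rb = oneB +ᵇ (zB *ᵇ uB)

  col-Z : ∀ j → col Z j ≈ (zₛ *ₛ (col oneB j -ₛ (col (uB *ᵇ zB) j *ₛ r)))
  col-Z j = ≈-trans (col-lift-*ᵇ zₛ (oneB -ᵇ ((uB *ᵇ zB) *ᵇ lift r)) j)
    (*ₛ-cong (≈-refl {zₛ}) (-ₛ-cong (≈-refl {col oneB j}) (col-*ᵇ-lift (uB *ᵇ zB) r j)))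

  col-Z-zero : col Z 0 ≈ zₛ
  col-Z-zero = begin
    col Z 0
      ≈⟨ col-Z 0 ⟩
    (zₛ *ₛ (1ₛ -ₛ (col (uB *ᵇ zB) 0 *ₛ r)))
      ≈⟨ *ₛ-cong (≈-refl {zₛ}) (-ₛ-cong (≈-refl {1ₛ}) (*ₛ-cong (col-uB-*ᵇ-zero zB) (≈-refl {r}))) ⟩
    (zₛ *ₛ (1ₛ -ₛ (0ₛ *ₛ r)))
      ≈⟨ solve 2 (λ z y → z :* (con (+ 1) :- con (+ 0) :* y) := z) (λ _ → refl) zₛ r ⟩
    zₛ
      ∎
    where open ≈-Reasoning

  col-Z-one : col Z 1 ≈ negₛ (zₛ *ₛ (zₛ *ₛ r))
  col-Z-one = begin
    col Z 1
      ≈⟨ col-Z 1 ⟩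
    (zₛ *ₛ (col oneB 1 -ₛ (col (uB *ᵇ zB) 1 *ₛ r)))
      ≈⟨ *ₛ-cong (≈-refl {zₛ}) (-ₛ-cong (col-lift-suc 1ₛ 0) (*ₛ-cong (col-uB-*ᵇ-suc zB 0) (≈-refl {r}))) ⟩
    (zₛ *ₛ (0ₛ -ₛ (zₛ *ₛ r)))
      ≈⟨ solve 2 (λ z y → z :* (con (+ 0) :- z :* y) := :- (z :* (z :* y))) (λ _ → refl) zₛ r ⟩
    negₛ (zₛ *ₛ (zₛ *ₛ r))
      ∎
    where open ≈-Reasoning

  col-Z-suc-suc : ∀ j → col Z (suc (suc j)) ≈ 0ₛ
  col-Z-suc-suc j = begin
    col Z (suc (suc j))
      ≈⟨ col-Z (suc (suc j)) ⟩
    (zₛ *ₛ (col oneB (suc (suc j)) -ₛ (col (uB *ᵇ zB) (suc (suc j)) *ₛ r)))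
      ≈⟨ *ₛ-cong (≈-refl {zₛ}) (-ₛ-cong (col-lift-suc 1ₛ (suc j))
           (*ₛ-cong (≈-trans (col-uB-*ᵇ-suc zB (suc j)) (col-lift-suc zₛ j)) (≈-refl {r}))) ⟩
    (zₛ *ₛ (0ₛ -ₛ (0ₛ *ₛ r)))
      ≈⟨ solve 2 (λ z y → z :* (con (+ 0) :- con (+ 0) :* y) := con (+ 0)) (λ _ → refl) zₛ r ⟩
    0ₛ
      ∎
    where open ≈-Reasoning

  col-Rb : ∀ j → col Rb j ≈ (col oneB j +ₛ (zₛ *ₛ col uB j))
  col-Rb j = +ₛ-cong (≈-refl {col oneB j}) (col-lift-*ᵇ zₛ uB j)

  col-Rb-zero : col Rb 0 ≈ 1ₛ
  col-Rb-zero = ≈-trans (col-Rb 0)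
    (≈-trans (+ₛ-cong (≈-refl {1ₛ}) (*ₛ-cong (≈-refl {zₛ}) col-uB-zero))
             (solve 1 (λ z → con (+ 1) :+ z :* con (+ 0) := con (+ 1)) (λ _ → refl) zₛ))
    where
    col-uB-zero : col uB 0 ≈ 0ₛ
    col-uB-zero zero    = refl
    col-uB-zero (suc n) = refl

  col-Rb-one : col Rb 1 ≈ zₛ
  col-Rb-one = ≈-trans (col-Rb 1)
    (≈-trans (+ₛ-cong (col-lift-suc 1ₛ 0) (*ₛ-cong (≈-refl {zₛ}) col-uB-one))
             (solve 1 (λ z → con (+ 0) :+ z :* con (+ 1) := z) (λ _ → refl) zₛ))
    where
    col-uB-one : col uB 1 ≈ 1ₛ
    col-uB-one zero    = refl
    col-uB-one (suc n) = refl

  col-Rb-suc-suc : ∀ j → col Rb (suc (suc j)) ≈ 0ₛ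
  col-Rb-suc-suc j = ≈-trans (col-Rb (suc (suc j)))
    (≈-trans (+ₛ-cong (col-lift-suc 1ₛ (suc j)) (*ₛ-cong (≈-refl {zₛ}) col-uB-high))
             (solve 1 (λ z → con (+ 0) :+ z :* con (+ 0) := con (+ 0)) (λ _ → refl) zₛ))
    where
    col-uB-high : col uB (suc (suc j)) ≈ 0ₛ
    col-uB-high zero    = refl
    col-uB-high (suc n) = refl

  ρ-column-suc : ∀ k →
    (negₛ ((zₛ *ₛ r) *ₛ (ρ k +ₛ (zₛ *ₛ ρ⁻ k))) +ₛ (ρ (suc k) +ₛ (zₛ *ₛ ρ⁻ (suc k))))
    ≈ (col Rb (suc k) *ₛ r)
  ρ-column-suc zero = ≈-trans
    (solve 2 (λ z y → :- ((z :* y) :* (y :+ z :* con (+ 0))) :+ (((z :* y) :* y) :+ z :* y)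
                    := z :* y)
           (λ _ → refl) zₛ r)
    (*ₛ-cong (≈-sym col-Rb-one) (≈-refl {r}))
  ρ-column-suc (suc k) = ≈-trans
    (solve 3 (λ z y g → :- ((z :* y) :* ((z :* y) :* g :+ z :* g))
                        :+ ((z :* y) :* ((z :* y) :* g) :+ z :* ((z :* y) :* g)) := con (+ 0) :* y)
           (λ _ → refl) zₛ r (ρ k))
    (*ₛ-cong (≈-sym (col-Rb-suc-suc k)) (≈-refl {r}))

  lhs-column : ∀ k → col (S *ᵇ Z) k ≈ (col Rb k *ₛ r)
  lhs-column zero = begin
    (col S 0 *ₛ col Z 0)  ≈⟨ *ₛ-cong (≈-refl {col S 0}) col-Z-zero ⟩
    (col S 0 *ₛ zₛ)       ≈⟨ *ₛ-comm (col S 0) zₛ ⟩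
    (zₛ *ₛ col S 0)       ≈⟨ z*col-S 0 ⟩
    (r +ₛ (zₛ *ₛ 0ₛ))     ≈⟨ solve 2 (λ z y → y :+ z :* con (+ 0) := con (+ 1) :* y) (λ _ → refl) zₛ r ⟩
    (1ₛ *ₛ r)             ≈⟨ *ₛ-cong (≈-sym col-Rb-zero) (≈-refl {r}) ⟩
    (col Rb 0 *ₛ r)       ∎
    where open ≈-Reasoning
  lhs-column (suc k) = begin
    col (S *ᵇ Z) (suc k)
      ≈⟨ col-*ᵇ-suc S Z (λ n j → trans (col-Z-suc-suc j n) (0ₛ-coeff n)) k ⟩
    ((col S k *ₛ col Z 1) +ₛ (col S (suc k) *ₛ col Z 0))
      ≈⟨ +ₛ-cong (*ₛ-cong (≈-refl {col S k}) col-Z-one)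
                 (*ₛ-cong (≈-refl {col S (suc k)}) col-Z-zero) ⟩
    ((col S k *ₛ negₛ (zₛ *ₛ (zₛ *ₛ r))) +ₛ (col S (suc k) *ₛ zₛ))
      ≈⟨ solve 4 (λ z y s s′ → s :* (:- (z :* (z :* y))) :+ s′ :* z
                              := :- ((z :* y) :* (z :* s)) :+ z :* s′)
               (λ _ → refl) zₛ r (col S k) (col S (suc k)) ⟩
    (negₛ ((zₛ *ₛ r) *ₛ (zₛ *ₛ col S k)) +ₛ (zₛ *ₛ col S (suc k)))
      ≈⟨ +ₛ-cong (negₛ-cong (*ₛ-cong (≈-refl {zₛ *ₛ r}) (z*col-S k))) (z*col-S (suc k)) ⟩
    (negₛ ((zₛ *ₛ r) *ₛ (ρ k +ₛ (zₛ *ₛ ρ⁻ k))) +ₛ (ρ (suc k) +ₛ (zₛ *ₛ ρ⁻ (suc k))))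
      ≈⟨ ρ-column-suc k ⟩
    (col Rb (suc k) *ₛ r)            ∎
    where open ≈-Reasoning

mainTheorem13 : (W r₁ : Series)
    → W 0 ≡ + 1
    → (∀ n → (W *ₛ W) n ≡ poly (+ 1 ∷ -[1+ 1 ] ∷ + 1 ∷ -[1+ 3 ] ∷ []) n)
    → (∀ n → (poly (+ 0 ∷ + 0 ∷ + 2 ∷ []) *ₛ r₁) n ≡ (poly (+ 1 ∷ -[1+ 0 ] ∷ []) -ₛ W) n)
    → ∀ n k → (S *ᵇ (zB *ᵇ (oneB -ᵇ ((uB *ᵇ zB) *ᵇ lift r₁)))) n k
              ≡ ((oneB +ᵇ (zB *ᵇ uB)) *ᵇ lift r₁) n k
mainTheorem13 W r₁ _ W²≈P 2z²r₁≈1-z-W n k =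
  trans (lhs-column k n) (sym (Bivariate.col-*ᵇ-lift Rb r₁ k n))
  where
  open Solution W r₁ W²≈P 2z²r₁≈1-z-W
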